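{- Let $r\ge2$ and let $g,G$ be functions of $x$ with $G(x)=g(x)\prod_{n\ge0}\frac{1}{1-xq^n}$. Then [$g(0)=1$ and $g$ satisfies $$\prod_{i=1}^{r-1}(1-dxu_i)g(x)=g(xq)+\sum_{i=1}^{r-1}\Big(\sum_{m=0}^{r-1-i}d^mx\,e_{i+m}(u_1,\dots,u_{r-1})\big((-x)^{m-1}{i+m-1\brack m-1}_q+(-x)^m{i+m\brack m}_q\big)\Big)\prod_{h=1}^{i-1}(1-xq^h)g(xq^i)\,]$$ if and only if [$G(0)=1$ and $G$ satisfies $$\Big(1+\sum_{i=1}^r\big(d^{i-1}e_{i-1}(u_1,\dots,u_{r-1})+d^ie_i(u_1,\dots,u_{r-1})\big)(-x)^i\Big)G(x)=G(xq)+\sum_{i=1}^r\sum_{m=1}^{r-i}\big(d^{m-1}e_{i+m-1}(u_1,\dots,u_{r-1})+d^me_{i+m}(u_1,\dots,u_{r-1})\big){i+m-1\brack m-1}_q(-1)^{m+1}x^mG(xq^i)\,].$$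
   Context: Functions are functions of $x$ with $u_1,\dots,u_{r-1},d,q$ as parameters. ${m\brack s}_q=\prod_{t=0}^{s-1}\frac{1-q^{m-t}}{1-q^{t+1}}$ for $0\le s\le m$, and $0$ otherwise. $e_n(u_1,\dots,u_s)$ is the $n$-th elementary symmetric polynomial in $u_1,\dots,u_s$, with $e_0=1$ and $e_n=0$ for $n<0$ or $n>s$. -}

module Defs where

open import Level using (Level)
open import Data.Nat as N using (ℕ; zero; suc; _∸_; _≤?_)
open import Data.Vec using (Vec; []; _∷_; lookup)
open import Data.Fin using (Fin; fromℕ<)
open import Data.Product using (_×_)
open import Relation.Nullary using (yes; no)
open import Algebra.Bundles using (CommutativeRing)

-- Formal power series in x over a commutative ring R (which contains the
-- parameters q, d, u_1, …, u_{r-1}).  A series is its coefficient sequence.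
module Series {c ℓ : Level} (R : CommutativeRing c ℓ) where
  open CommutativeRing R

  Series : Set c
  Series = ℕ → Carrier

  _≋_ : Series → Series → Set ℓ
  f ≋ g = ∀ n → f n ≈ g n

  infix 4 _≋_

  pow : Carrier → ℕ → Carrier
  pow a zero = 1#
  pow a (suc n) = a * pow a n

  sumR : ℕ → (ℕ → Carrier) → Carrier
  sumR zero f = 0#
  sumR (suc n) f = sumR n f + f n

  prodR : ℕ → (ℕ → Carrier) → Carrier
  prodR zero f = 1#
  prodR (suc n) f = prodR n f * f n

  cS : Carrier → Series
  cS a zero = a
  cS a (suc n) = 0#

  0S 1S : Series
  0S = cS 0#
  1S = cS 1#

  X : Series
  X zero = 0#
  X (suc zero) = 1#
  X (suc (suc n)) = 0#

  _⊕_ : Series → Series → Series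
  (f ⊕ g) n = f n + g n

  ⊖_ : Series → Series
  (⊖ f) n = - (f n)

  _⊝_ : Series → Series → Series
  f ⊝ g = f ⊕ (⊖ g)

  _·S_ : Carrier → Series → Series
  (a ·S f) n = a * f n

  _⊛_ : Series → Series → Series
  (f ⊛ g) n = sumR (suc n) (λ k → f k * g (n ∸ k))

  infixl 7 _⊛_ _·S_
  infixl 6 _⊕_ _⊝_

  powS : Series → ℕ → Series
  powS f zero = 1S
  powS f (suc n) = f ⊛ powS f n

  sumS : ℕ → (ℕ → Series) → Series
  sumS zero F = 0S
  sumS (suc n) F = sumS n F ⊕ F n

  prodS : ℕ → (ℕ → Series) → Series
  prodS zero F = 1S
  prodS (suc n) F = prodS n F ⊛ F n

  -- substitution x ↦ a·x :  f(ax)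
  dil : Carrier → Series → Series
  dil a f n = pow a n * f n

  esym : {s : ℕ} → ℕ → Vec Carrier s → Carrier
  esym zero v = 1#
  esym (suc n) [] = 0#
  esym (suc n) (a ∷ v) = esym (suc n) v + a * esym n v

  -- Parameters: q and a family inv with (1 - q^(t+1)) * inv t ≈ 1,
  -- i.e. inv t = 1/(1-q^(t+1)).
  module WithQ (q : Carrier) (inv : ℕ → Carrier) where

    qbin : ℕ → ℕ → Carrier
    qbin m s with s ≤? m
    ... | yes _ = prodR s (λ t → (1# - pow q (m ∸ t)) * inv t)
    ... | no _  = 0#

    -- E(x) = Π_{n≥0} 1/(1-xq^n) = Σ_k x^k / ((1-q)(1-q^2)…(1-q^k))  (Euler)
    E : Series
    E k = prodR k inv

    module WithParams (r : ℕ) (d : Carrier) (u : Vec Carrier (r ∸ 1)) where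

      e : ℕ → Carrier
      e n = esym n u

      -- x·(-x)^{m-1} [i+m-1 brack m-1]_q, which is 0 for m = 0
      -- (lower index -1 < 0 gives the q-binomial 0)
      lowerPart : ℕ → ℕ → Series
      lowerPart i zero = 0S
      lowerPart i (suc m') = qbin (i N.+ m') m' ·S (X ⊛ powS (⊖ X) m')

      -- Σ_{m=0}^{r-1-i} d^m x e_{i+m} ((-x)^{m-1}[i+m-1,m-1] + (-x)^m [i+m,m])
      -- (the factor x distributed into both summands)
      coeffg : ℕ → Series
      coeffg i = sumS (suc (r ∸ 1 ∸ i)) (λ m →
        (pow d m * e (i N.+ m)) ·S
          (lowerPart i m ⊕ qbin (i N.+ m) m ·S (X ⊛ powS (⊖ X) m)))

      gEquation : Series → Set ℓ
      gEquation g =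
        prodS (r ∸ 1) (λ j → 1S ⊝ (d * lookupU j) ·S X) ⊛ g
          ≋ dil q g ⊕ sumS (r ∸ 1) (λ j → let i = suc j in
              coeffg i
              ⊛ prodS (i ∸ 1) (λ k → 1S ⊝ pow q (suc k) ·S X)
              ⊛ dil (pow q i) g)
        where
          lookupU : ℕ → Carrier
          lookupU j with j N.<? (r ∸ 1)
          ... | yes p = lookup u (fromℕ< p)
          ... | no _  = 0#

      GEquation : Series → Set ℓ
      GEquation G =
        (1S ⊕ sumS r (λ j → let i = suc j in
            (pow d (i ∸ 1) * e (i ∸ 1) + pow d i * e i) ·S powS (⊖ X) i)) ⊛ G
          ≋ dil q G ⊕ sumS r (λ j → let i = suc j in
              sumS (r ∸ i) (λ k → let m = suc k in
                ((pow d (m ∸ 1) * e (i N.+ m ∸ 1) + pow d m * e (i N.+ m))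
                   * qbin (i N.+ m ∸ 1) (m ∸ 1) * pow (- 1#) (suc m))
                ·S (powS X m ⊛ dil (pow q i) G)))

{-# OPTIONS --safe #-}
-- E(x) = Π_{n≥0} 1/(1 - x q^n) satisfies Euler's equation E(qx) = (1 - x) E(x), hence
-- E(q^i x) = Π_{h=1}^{i-1} (1 - x q^h) · E(qx). Put G = g E and multiply the equation for g by
-- E(qx). On the left, Π_{i=1}^{r-1} (1 - d u_i x) = Σ_j d^j e_j (-x)^j, and (1 - x) times this sum is
-- the left factor of the equation for G. On the right, g(x q^i) Π_{h=1}^{i-1} (1 - x q^h) E(qx)
-- is G(x q^i), and summation by parts turns the coefficient of this term into that of G(x q^i).
-- So the equation for G is E(qx) times the equation for g; E(qx) has constant term 1, hence is
-- cancellable among formal power series, which gives the converse.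
module Submission where

open import Algebra.Bundles using (CommutativeRing)
open import Data.Fin using (fromℕ<)
open import Data.Nat as N using (ℕ; zero; suc; _∸_; _<_; s≤s; z≤n)
open import Data.Nat.Induction using (<-rec)
import Data.Nat.Properties as ℕ
open import Data.Product using (_×_; _,_)
open import Data.Vec using (Vec; []; _∷_; map; lookup)
open import Data.Vec.Properties using (lookup-map)
open import Function.Bundles using (_⇔_; mk⇔)
open import Level using (Level)
open import Relation.Binary.PropositionalEquality as ≡ using (_≡_)
open import Relation.Nullary using (yes; no; contradiction)

open import Defs

module RingSums {a ℓ : Level} (A : CommutativeRing a ℓ) where
  open CommutativeRing A
  open Series A using (sumR; prodR; pow; esym)
  open import Algebra.Properties.CommutativeSemigroup +-commutativeSemigroup
    using () renaming (interchange to +-interchange)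
  open import Algebra.Properties.CommutativeSemigroup *-commutativeSemigroup
    using () renaming (interchange to *-interchange)
  open import Algebra.Properties.Ring ring using (-1*x≈-x; -‿involutive)
  open import Relation.Binary.Reasoning.Setoid setoid

  sumR-cong< : ∀ n {f g : ℕ → Carrier} → (∀ k → k < n → f k ≈ g k) → sumR n f ≈ sumR n g
  sumR-cong< zero    f≈g = refl
  sumR-cong< (suc n) f≈g =
    +-cong (sumR-cong< n (λ k k<n → f≈g k (ℕ.m<n⇒m<1+n k<n))) (f≈g n ℕ.≤-refl)

  sumR-cong : ∀ n {f g : ℕ → Carrier} → (∀ k → f k ≈ g k) → sumR n f ≈ sumR n g
  sumR-cong n f≈g = sumR-cong< n (λ k _ → f≈g k)

  sumR-zero : ∀ n {f : ℕ → Carrier} → (∀ k → k < n → f k ≈ 0#) → sumR n f ≈ 0#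
  sumR-zero zero    f≈0 = refl
  sumR-zero (suc n) f≈0 =
    trans (+-cong (sumR-zero n (λ k k<n → f≈0 k (ℕ.m<n⇒m<1+n k<n))) (f≈0 n ℕ.≤-refl)) (+-identityʳ 0#)

  sumR-+ : ∀ n (f g : ℕ → Carrier) → sumR n (λ k → f k + g k) ≈ sumR n f + sumR n g
  sumR-+ zero    f g = sym (+-identityˡ 0#)
  sumR-+ (suc n) f g = trans (+-cong (sumR-+ n f g) refl) (+-interchange _ _ _ _)

  *-distribˡ-sumR : ∀ n x (f : ℕ → Carrier) → x * sumR n f ≈ sumR n (λ k → x * f k)
  *-distribˡ-sumR zero    x f = zeroʳ x
  *-distribˡ-sumR (suc n) x f = trans (distribˡ x _ _) (+-cong (*-distribˡ-sumR n x f) refl)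

  *-distribʳ-sumR : ∀ n x (f : ℕ → Carrier) → sumR n f * x ≈ sumR n (λ k → f k * x)
  *-distribʳ-sumR n x f =
    trans (*-comm _ x) (trans (*-distribˡ-sumR n x f) (sumR-cong n (λ k → *-comm x (f k))))

  sumR-head : ∀ n (f : ℕ → Carrier) → sumR (suc n) f ≈ f 0 + sumR n (λ k → f (suc k))
  sumR-head zero    f = +-comm 0# (f 0)
  sumR-head (suc n) f = trans (+-cong (sumR-head n f) refl) (+-assoc _ _ _)

  sumR-shift : ∀ n (h : ℕ → Carrier) → h 0 ≈ 0# → h n ≈ 0# →
    sumR n (λ k → h (suc k)) ≈ sumR n h
  sumR-shift zero    h h0≈0 hn≈0 = refl
  sumR-shift (suc n) h h0≈0 hn≈0 = begin
    sumR n (λ k → h (suc k)) + h (suc n) ≈⟨ +-cong refl hn≈0 ⟩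
    sumR n (λ k → h (suc k)) + 0#        ≈⟨ +-identityʳ _ ⟩
    sumR n (λ k → h (suc k))             ≈⟨ +-identityˡ _ ⟨
    0# + sumR n (λ k → h (suc k))        ≈⟨ +-cong h0≈0 refl ⟨
    h 0 + sumR n (λ k → h (suc k))       ≈⟨ sumR-head n h ⟨
    sumR (suc n) h                       ∎

  sumR-reverse : ∀ n (f : ℕ → Carrier) → sumR n f ≈ sumR n (λ k → f (n ∸ suc k))
  sumR-reverse zero    f = refl
  sumR-reverse (suc n) f = begin
    sumR n f + f n                         ≈⟨ +-cong (sumR-reverse n f) refl ⟩
    sumR n (λ k → f (n ∸ suc k)) + f n     ≈⟨ +-comm _ _ ⟩
    f n + sumR n (λ k → f (n ∸ suc k))     ≈⟨ sumR-head n (λ k → f (n ∸ k)) ⟨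
    sumR (suc n) (λ k → f (n ∸ k))         ∎

  sumR-triangle : ∀ n (F : ℕ → ℕ → Carrier) →
    sumR (suc n) (λ k → sumR (suc k) (λ l → F l k)) ≈
    sumR (suc n) (λ l → sumR (suc (n ∸ l)) (λ t → F l (l N.+ t)))
  sumR-triangle zero    F = refl
  sumR-triangle (suc n) F = begin
    sumR (suc n) (λ k → sumR (suc k) (λ l → F l k)) + (column + F (suc n) (suc n))
      ≈⟨ +-cong (sumR-triangle n F) refl ⟩
    sumR (suc n) (row n) + (column + F (suc n) (suc n))
      ≈⟨ +-assoc _ _ _ ⟨
    (sumR (suc n) (row n) + column) + F (suc n) (suc n)
      ≈⟨ +-cong (sumR-+ (suc n) _ _) last-row ⟨
    sumR (suc n) (λ l → row n l + F l (suc n)) + row (suc n) (suc n)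
      ≈⟨ +-cong (sumR-cong< (suc n) extend-row) refl ⟩
    sumR (suc n) (row (suc n)) + row (suc n) (suc n) ∎
    where
    row : ℕ → ℕ → Carrier
    row n l = sumR (suc (n ∸ l)) (λ t → F l (l N.+ t))
    column : Carrier
    column = sumR (suc n) (λ l → F l (suc n))
    last-row : row (suc n) (suc n) ≈ F (suc n) (suc n)
    last-row = begin
      sumR (suc (n ∸ n)) (λ t → F (suc n) (suc n N.+ t))
        ≡⟨ ≡.cong (λ m → sumR (suc m) (λ t → F (suc n) (suc n N.+ t))) (ℕ.n∸n≡0 n) ⟩
      0# + F (suc n) (suc n N.+ 0)   ≈⟨ +-identityˡ _ ⟩
      F (suc n) (suc n N.+ 0)        ≡⟨ ≡.cong (F (suc n)) (ℕ.+-identityʳ (suc n)) ⟩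
      F (suc n) (suc n)              ∎
    extend-row : ∀ l → l < suc n → row n l + F l (suc n) ≈ row (suc n) l
    extend-row l l<1+n = begin
      row n l + F l (suc n)
        ≡⟨ ≡.cong (λ m → row n l + F l m) l+[1+n∸l]≡1+n ⟨
      row n l + F l (l N.+ suc (n ∸ l))
        ≡⟨ ≡.cong (λ m → sumR (suc m) (λ t → F l (l N.+ t))) 1+n∸l≡1+[n∸l] ⟨
      row (suc n) l ∎
      where
      l≤n = ℕ.m<1+n⇒m≤n l<1+n
      1+n∸l≡1+[n∸l] : suc n ∸ l ≡ suc (n ∸ l)
      1+n∸l≡1+[n∸l] = ℕ.+-∸-assoc 1 l≤n
      l+[1+n∸l]≡1+n : l N.+ suc (n ∸ l) ≡ suc n
      l+[1+n∸l]≡1+n = ≡.trans (ℕ.+-suc l (n ∸ l)) (≡.cong suc (ℕ.m+[n∸m]≡n l≤n))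

  sumR-by-parts : ∀ n (a b L : ℕ → Carrier) → a n ≈ 0# → L 0 ≈ 0# → (∀ m → L (suc m) ≈ b m) →
    sumR n (λ k → (a k + a (suc k)) * b k) ≈ sumR n (λ m → a m * (L m + b m))
  sumR-by-parts n a b L aₙ≈0 L₀≈0 L[1+m]≈bₘ = begin
    sumR n (λ k → (a k + a (suc k)) * b k)
      ≈⟨ sumR-cong n (λ k → distribʳ (b k) (a k) (a (suc k))) ⟩
    sumR n (λ k → a k * b k + a (suc k) * b k)
      ≈⟨ sumR-+ n _ _ ⟩
    sumR n (λ k → a k * b k) + sumR n (λ k → a (suc k) * b k)
      ≈⟨ +-cong refl (sumR-cong n (λ k → *-cong refl (sym (L[1+m]≈bₘ k)))) ⟩
    sumR n (λ k → a k * b k) + sumR n (λ k → aL (suc k))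
      ≈⟨ +-cong refl (sumR-shift n aL aL₀≈0 aLₙ≈0) ⟩
    sumR n (λ k → a k * b k) + sumR n aL
      ≈⟨ +-comm _ _ ⟩
    sumR n aL + sumR n (λ k → a k * b k)
      ≈⟨ sumR-+ n _ _ ⟨
    sumR n (λ m → a m * L m + a m * b m)
      ≈⟨ sumR-cong n (λ m → distribˡ (a m) (L m) (b m)) ⟨
    sumR n (λ m → a m * (L m + b m)) ∎
    where
    aL : ℕ → Carrier
    aL m = a m * L m
    aL₀≈0 : aL 0 ≈ 0#
    aL₀≈0 = trans (*-cong refl L₀≈0) (zeroʳ _)
    aLₙ≈0 : aL n ≈ 0#
    aLₙ≈0 = trans (*-cong aₙ≈0 refl) (zeroˡ _)

  prodR-head : ∀ n (f : ℕ → Carrier) → prodR (suc n) f ≈ f 0 * prodR n (λ k → f (suc k))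
  prodR-head zero    f = *-comm 1# (f 0)
  prodR-head (suc n) f = trans (*-cong (prodR-head n f) refl) (*-assoc _ _ _)

  pow-cong : ∀ n {x y} → x ≈ y → pow x n ≈ pow y n
  pow-cong zero    x≈y = refl
  pow-cong (suc n) x≈y = *-cong x≈y (pow-cong n x≈y)

  pow-+ : ∀ x m n → pow x (m N.+ n) ≈ pow x m * pow x n
  pow-+ x zero    n = sym (*-identityˡ _)
  pow-+ x (suc m) n = trans (*-cong refl (pow-+ x m n)) (sym (*-assoc _ _ _))

  pow-* : ∀ x y n → pow (x * y) n ≈ pow x n * pow y n
  pow-* x y zero    = sym (*-identityˡ 1#)
  pow-* x y (suc n) = trans (*-cong refl (pow-* x y n)) (*-interchange _ _ _ _)

  pow-[-1]-suc-suc : ∀ n → pow (- 1#) (suc (suc n)) ≈ pow (- 1#) n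
  pow-[-1]-suc-suc n = trans (-1*x≈-x _) (trans (-‿cong (-1*x≈-x _)) (-‿involutive _))

  linear-*-polynomial : ∀ n a y (c : ℕ → Carrier) → c n ≈ 0# →
    (1# + a * y) * sumR n (λ j → c j * pow y j) ≈
    c 0 + sumR n (λ j → (c (suc j) + a * c j) * pow y (suc j))
  linear-*-polynomial n a y c cₙ≈0 = begin
    (1# + a * y) * sumR n h
      ≈⟨ distribʳ _ 1# (a * y) ⟩
    1# * sumR n h + (a * y) * sumR n h
      ≈⟨ +-cong (*-identityˡ _) (*-distribˡ-sumR n (a * y) h) ⟩
    sumR n h + sumR n (λ j → (a * y) * h j)
      ≈⟨ +-cong split-first refl ⟩
    (c 0 + sumR n (λ j → h (suc j))) + sumR n (λ j → (a * y) * h j)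
      ≈⟨ +-assoc _ _ _ ⟩
    c 0 + (sumR n (λ j → h (suc j)) + sumR n (λ j → (a * y) * h j))
      ≈⟨ +-cong refl (sumR-+ n _ _) ⟨
    c 0 + sumR n (λ j → h (suc j) + (a * y) * h j)
      ≈⟨ +-cong refl (sumR-cong n collect) ⟩
    c 0 + sumR n (λ j → (c (suc j) + a * c j) * pow y (suc j)) ∎
    where
    h : ℕ → Carrier
    h j = c j * pow y j
    split-first : sumR n h ≈ c 0 + sumR n (λ j → h (suc j))
    split-first = begin
      sumR n h                               ≈⟨ +-identityʳ _ ⟨
      sumR n h + 0#                          ≈⟨ +-cong refl (trans (*-cong cₙ≈0 refl) (zeroˡ _)) ⟨
      sumR (suc n) h                         ≈⟨ sumR-head n h ⟩
      c 0 * 1# + sumR n (λ j → h (suc j))    ≈⟨ +-cong (*-identityʳ _) refl ⟩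
      c 0 + sumR n (λ j → h (suc j))         ∎
    collect : ∀ j → h (suc j) + (a * y) * h j ≈ (c (suc j) + a * c j) * pow y (suc j)
    collect j = trans (+-cong refl (*-interchange a y (c j) (pow y j))) (sym (distribʳ _ _ _))

  esym-vanish : ∀ {s} (v : Vec Carrier s) n → s < n → esym n v ≈ 0#
  esym-vanish []      (suc n) _         = refl
  esym-vanish (a ∷ v) (suc n) (s≤s s<n) = begin
    esym (suc n) v + a * esym n v
      ≈⟨ +-cong (esym-vanish v (suc n) (ℕ.m<n⇒m<1+n s<n)) (*-cong refl (esym-vanish v n s<n)) ⟩
    0# + a * 0#
      ≈⟨ trans (+-identityˡ _) (zeroʳ a) ⟩
    0# ∎

  esym-map-* : ∀ {s} x (v : Vec Carrier s) n → esym n (map (x *_) v) ≈ pow x n * esym n v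
  esym-map-* x v       zero    = sym (*-identityˡ 1#)
  esym-map-* x []      (suc n) = sym (zeroʳ _)
  esym-map-* x (a ∷ v) (suc n) = begin
    esym (suc n) (map (x *_) v) + (x * a) * esym n (map (x *_) v)
      ≈⟨ +-cong (esym-map-* x v (suc n)) (*-cong refl (esym-map-* x v n)) ⟩
    pow x (suc n) * esym (suc n) v + (x * a) * (pow x n * esym n v)
      ≈⟨ +-cong refl (*-interchange x a (pow x n) (esym n v)) ⟩
    pow x (suc n) * esym (suc n) v + pow x (suc n) * (a * esym n v)
      ≈⟨ distribˡ _ _ _ ⟨
    pow x (suc n) * (esym (suc n) v + a * esym n v) ∎

module PowerSeries {c ℓ : Level} (R : CommutativeRing c ℓ) where
  open CommutativeRing R
  open Series R
  open RingSums R
  open import Algebra.Properties.CommutativeSemigroup *-commutativeSemigroup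
    using () renaming (interchange to *-interchange)
  open import Algebra.Properties.Ring ring using (-‿distribʳ-*)
  open import Relation.Binary.Reasoning.Setoid setoid

  0S-coeff : ∀ n → 0S n ≈ 0#
  0S-coeff zero    = refl
  0S-coeff (suc n) = refl

  cS-⊛ : ∀ a f → cS a ⊛ f ≋ a ·S f
  cS-⊛ a f n = begin
    sumR (suc n) (λ k → cS a k * f (n ∸ k))         ≈⟨ sumR-head n _ ⟩
    a * f n + sumR n (λ k → 0# * f (n ∸ suc k))     ≈⟨ +-cong refl (sumR-zero n (λ k _ → zeroˡ _)) ⟩
    a * f n + 0#                                    ≈⟨ +-identityʳ _ ⟩
    a * f n                                         ∎

  ⊛-cong : ∀ {f f′ g g′} → f ≋ f′ → g ≋ g′ → f ⊛ g ≋ f′ ⊛ g′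
  ⊛-cong f≋f′ g≋g′ n = sumR-cong (suc n) (λ k → *-cong (f≋f′ k) (g≋g′ (n ∸ k)))

  ⊛-comm : ∀ f g → f ⊛ g ≋ g ⊛ f
  ⊛-comm f g n = begin
    sumR (suc n) (λ k → f k * g (n ∸ k))                ≈⟨ sumR-reverse (suc n) _ ⟩
    sumR (suc n) (λ k → f (n ∸ k) * g (n ∸ (n ∸ k)))    ≈⟨ sumR-cong< (suc n) swap ⟩
    sumR (suc n) (λ k → g k * f (n ∸ k))                ∎
    where
    swap : ∀ k → k < suc n → f (n ∸ k) * g (n ∸ (n ∸ k)) ≈ g k * f (n ∸ k)
    swap k k<1+n =
      trans (*-comm _ _) (*-cong (reflexive (≡.cong g (ℕ.m∸[m∸n]≡n (ℕ.m<1+n⇒m≤n k<1+n)))) refl)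

  ⊛-identityˡ : ∀ f → 1S ⊛ f ≋ f
  ⊛-identityˡ f n = trans (cS-⊛ 1# f n) (*-identityˡ (f n))

  ⊛-distribˡ : ∀ f g h → f ⊛ (g ⊕ h) ≋ (f ⊛ g) ⊕ (f ⊛ h)
  ⊛-distribˡ f g h n = trans (sumR-cong (suc n) (λ k → distribˡ (f k) _ _)) (sumR-+ (suc n) _ _)

  ⊛-assoc : ∀ f g h → (f ⊛ g) ⊛ h ≋ f ⊛ (g ⊛ h)
  ⊛-assoc f g h n = begin
    sumR (suc n) (λ k → (f ⊛ g) k * h (n ∸ k))
      ≈⟨ sumR-cong (suc n) (λ k → *-distribʳ-sumR (suc k) (h (n ∸ k)) _) ⟩
    sumR (suc n) (λ k → sumR (suc k) (λ l → f l * g (k ∸ l) * h (n ∸ k)))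
      ≈⟨ sumR-triangle n _ ⟩
    sumR (suc n) (λ l → sumR (suc (n ∸ l)) (λ t → f l * g (l N.+ t ∸ l) * h (n ∸ (l N.+ t))))
      ≈⟨ sumR-cong (suc n) (λ l → sumR-cong (suc (n ∸ l)) (λ t → trans (*-assoc _ _ _) (reindex l t))) ⟩
    sumR (suc n) (λ l → sumR (suc (n ∸ l)) (λ t → f l * (g t * h (n ∸ l ∸ t))))
      ≈⟨ sumR-cong (suc n) (λ l → *-distribˡ-sumR (suc (n ∸ l)) (f l) _) ⟨
    sumR (suc n) (λ l → f l * (g ⊛ h) (n ∸ l)) ∎
    where
    reindex : ∀ l t → f l * (g (l N.+ t ∸ l) * h (n ∸ (l N.+ t))) ≈ f l * (g t * h (n ∸ l ∸ t))
    reindex l t =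
      reflexive (≡.cong₂ (λ i j → f l * (g i * h j)) (ℕ.m+n∸m≡n l t) (≡.sym (ℕ.∸-+-assoc n l t)))

  -- A record rather than ≋ itself, so that both series can be inferred from an equation.
  record _≐_ (f g : Series) : Set ℓ where
    constructor ≋⇒≐
    field ≐⇒≋ : f ≋ g
  open _≐_ public

  infix 4 _≐_

  ≐-refl : ∀ f → f ≐ f
  ≐-refl f = ≋⇒≐ (λ n → refl)

  seriesRing : CommutativeRing c ℓ
  seriesRing = record
    { Carrier = Series ; _≈_ = _≐_ ; _+_ = _⊕_ ; _*_ = _⊛_ ; -_ = ⊖_ ; 0# = 0S ; 1# = 1S
    ; isCommutativeRing = record
      { isRing = record
        { +-isAbelianGroup = record
          { isGroup = record
            { isMonoid = record
              { isSemigroup = record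
                { isMagma = record
                  { isEquivalence = record
                    { refl  = ≐-refl _
                    ; sym   = λ f≐g → ≋⇒≐ (λ n → sym (≐⇒≋ f≐g n))
                    ; trans = λ f≐g g≐h → ≋⇒≐ (λ n → trans (≐⇒≋ f≐g n) (≐⇒≋ g≐h n)) }
                  ; ∙-cong = λ f≐f′ g≐g′ →
                      ≋⇒≐ (λ n → +-cong (≐⇒≋ f≐f′ n) (≐⇒≋ g≐g′ n)) }
                ; assoc = λ f g h → ≋⇒≐ (λ n → +-assoc (f n) (g n) (h n)) }
              ; identity = (λ f → ≋⇒≐ (λ n → trans (+-cong (0S-coeff n) refl) (+-identityˡ (f n))))
                         , (λ f → ≋⇒≐ (λ n → trans (+-cong refl (0S-coeff n)) (+-identityʳ (f n)))) }
            ; inverse = (λ f → ≋⇒≐ (λ n → trans (-‿inverseˡ (f n)) (sym (0S-coeff n))))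
                      , (λ f → ≋⇒≐ (λ n → trans (-‿inverseʳ (f n)) (sym (0S-coeff n))))
            ; ⁻¹-cong = λ f≐g → ≋⇒≐ (λ n → -‿cong (≐⇒≋ f≐g n)) }
          ; comm = λ f g → ≋⇒≐ (λ n → +-comm (f n) (g n)) }
        ; *-cong = λ f≐f′ g≐g′ → ≋⇒≐ (⊛-cong (≐⇒≋ f≐f′) (≐⇒≋ g≐g′))
        ; *-assoc = λ f g h → ≋⇒≐ (⊛-assoc f g h)
        ; *-identity = (λ f → ≋⇒≐ (⊛-identityˡ f))
                     , (λ f → ≋⇒≐ (λ n → trans (⊛-comm f 1S n) (⊛-identityˡ f n)))
        ; distrib = (λ f g h → ≋⇒≐ (⊛-distribˡ f g h))
                  , (λ f g h → ≋⇒≐ (λ n → trans (⊛-comm (g ⊕ h) f n)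
                                 (trans (⊛-distribˡ f g h n) (+-cong (⊛-comm f g n) (⊛-comm f h n))))) }
      ; *-comm = λ f g → ≋⇒≐ (⊛-comm f g) } }

  f⊛δ≋0⇒δ≋0 : ∀ f δ → f 0 ≈ 1# → f ⊛ δ ≋ 0S → δ ≋ 0S
  f⊛δ≋0⇒δ≋0 f δ f₀≈1 fδ≋0 = <-rec (λ n → δ n ≈ 0S n) δₙ≈0
    where
    δₙ≈0 : ∀ n → (∀ {m} → m < n → δ m ≈ 0S m) → δ n ≈ 0S n
    δₙ≈0 n δₘ≈0 = begin
      δ n                                     ≈⟨ *-identityʳ _ ⟨
      δ n * 1#                                ≈⟨ *-cong refl fₙ₋ₙ≈1 ⟨
      δ n * f (n ∸ n)                         ≈⟨ +-identityˡ _ ⟨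
      0# + δ n * f (n ∸ n)                    ≈⟨ +-cong (sumR-zero n δₖfₙ₋ₖ≈0) refl ⟨
      sumR (suc n) (λ k → δ k * f (n ∸ k))    ≈⟨ ⊛-comm δ f n ⟩
      (f ⊛ δ) n                               ≈⟨ fδ≋0 n ⟩
      0S n                                    ∎
      where
      fₙ₋ₙ≈1 : f (n ∸ n) ≈ 1#
      fₙ₋ₙ≈1 = trans (reflexive (≡.cong f (ℕ.n∸n≡0 n))) f₀≈1
      δₖfₙ₋ₖ≈0 : ∀ k → k < n → δ k * f (n ∸ k) ≈ 0#
      δₖfₙ₋ₖ≈0 k k<n = trans (*-cong (trans (δₘ≈0 k<n) (0S-coeff k)) refl) (zeroˡ _)

  cS-cong : ∀ {a b} → a ≈ b → cS a ≋ cS b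
  cS-cong a≈b zero    = a≈b
  cS-cong a≈b (suc n) = refl

  cS-+ : ∀ a b → cS (a + b) ≋ cS a ⊕ cS b
  cS-+ a b zero    = refl
  cS-+ a b (suc n) = sym (+-identityʳ 0#)

  cS-* : ∀ a b → cS (a * b) ≋ cS a ⊛ cS b
  cS-* a b n = sym (trans (cS-⊛ a (cS b) n) (a·cS[b] n))
    where
    a·cS[b] : a ·S cS b ≋ cS (a * b)
    a·cS[b] zero    = refl
    a·cS[b] (suc n) = zeroʳ a

  X-⊛-zero : ∀ f → (X ⊛ f) 0 ≈ 0#
  X-⊛-zero f = trans (+-identityˡ _) (zeroˡ (f 0))

  X-⊛-suc : ∀ f n → (X ⊛ f) (suc n) ≈ f n
  X-⊛-suc f n = begin
    sumR (suc (suc n)) (λ k → X k * f (suc n ∸ k))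
      ≈⟨ sumR-head (suc n) _ ⟩
    0# * f (suc n) + sumR (suc n) (λ k → X (suc k) * f (n ∸ k))
      ≈⟨ +-cong (zeroˡ _) (sumR-head n _) ⟩
    0# + (1# * f n + sumR n (λ k → 0# * f (n ∸ suc k)))
      ≈⟨ +-identityˡ _ ⟩
    1# * f n + sumR n (λ k → 0# * f (n ∸ suc k))
      ≈⟨ +-cong (*-identityˡ _) (sumR-zero n (λ k _ → zeroˡ _)) ⟩
    f n + 0#
      ≈⟨ +-identityʳ _ ⟩
    f n ∎

  dil-cong : ∀ a {f g} → f ≋ g → dil a f ≋ dil a g
  dil-cong a f≋g n = *-cong refl (f≋g n)

  dil-⊛ : ∀ a f g → dil a (f ⊛ g) ≋ dil a f ⊛ dil a g
  dil-⊛ a f g n = begin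
    pow a n * sumR (suc n) (λ k → f k * g (n ∸ k))
      ≈⟨ *-distribˡ-sumR (suc n) _ _ ⟩
    sumR (suc n) (λ k → pow a n * (f k * g (n ∸ k)))
      ≈⟨ sumR-cong< (suc n) split-power ⟩
    sumR (suc n) (λ k → (pow a k * f k) * (pow a (n ∸ k) * g (n ∸ k))) ∎
    where
    split-power : ∀ k → k < suc n →
      pow a n * (f k * g (n ∸ k)) ≈ (pow a k * f k) * (pow a (n ∸ k) * g (n ∸ k))
    split-power k k<1+n = begin
      pow a n * (f k * g (n ∸ k))
        ≡⟨ ≡.cong (λ m → pow a m * (f k * g (n ∸ k))) (ℕ.m+[n∸m]≡n (ℕ.m<1+n⇒m≤n k<1+n)) ⟨
      pow a (k N.+ (n ∸ k)) * (f k * g (n ∸ k))        ≈⟨ *-cong (pow-+ a k (n ∸ k)) refl ⟩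
      (pow a k * pow a (n ∸ k)) * (f k * g (n ∸ k))    ≈⟨ *-interchange _ _ _ _ ⟩
      (pow a k * f k) * (pow a (n ∸ k) * g (n ∸ k))    ∎

  dil-⊕ : ∀ a f g → dil a (f ⊕ g) ≋ dil a f ⊕ dil a g
  dil-⊕ a f g n = distribˡ (pow a n) (f n) (g n)

  dil-⊖ : ∀ a f → dil a (⊖ f) ≋ ⊖ dil a f
  dil-⊖ a f n = sym (-‿distribʳ-* (pow a n) (f n))

  dil-cS : ∀ a b → dil a (cS b) ≋ cS b
  dil-cS a b zero    = *-identityˡ b
  dil-cS a b (suc n) = zeroʳ _

  dil-X : ∀ a → dil a X ≋ a ·S X
  dil-X a zero          = trans (zeroʳ _) (sym (zeroʳ a))
  dil-X a (suc zero)    = trans (*-identityʳ _) (trans (*-identityʳ a) (sym (*-identityʳ a)))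
  dil-X a (suc (suc n)) = trans (zeroʳ _) (sym (zeroʳ a))

  dil-dil : ∀ a b f → dil a (dil b f) ≋ dil (a * b) f
  dil-dil a b f n = trans (sym (*-assoc _ _ _)) (*-cong (sym (pow-* a b n)) refl)

  module EulerCoefficients (q : Carrier) (inv : ℕ → Carrier)
                           (inv-spec : ∀ t → (1# - pow q (suc t)) * inv t ≈ 1#) where
    open WithQ q inv
    open import Algebra.Properties.AbelianGroup +-abelianGroup using (xyx⁻¹≈y)
    open import Algebra.Properties.Group +-group using (//-rightDividesʳ)
    open import Algebra.Properties.CommutativeSemigroup *-commutativeSemigroup using (x∙yz≈y∙xz)
    open import Algebra.Properties.Ring ring using (-0#≈0#)

    E-suc : ∀ m → E (suc m) ≈ pow q (suc m) * E (suc m) + E m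
    E-suc m = begin
      E m * inv m                                  ≈⟨ *-identityˡ _ ⟨
      1# * (E m * inv m)                           ≈⟨ *-cong (xyx⁻¹≈y p 1#) refl ⟨
      (p + 1# - p) * (E m * inv m)                 ≈⟨ *-cong (+-assoc p 1# (- p)) refl ⟩
      (p + (1# - p)) * (E m * inv m)               ≈⟨ distribʳ _ p (1# - p) ⟩
      p * E (suc m) + (1# - p) * (E m * inv m)     ≈⟨ +-cong refl (x∙yz≈y∙xz (1# - p) (E m) (inv m)) ⟩
      p * E (suc m) + E m * ((1# - p) * inv m)     ≈⟨ +-cong refl (*-cong refl (inv-spec m)) ⟩
      p * E (suc m) + E m * 1#                     ≈⟨ +-cong refl (*-identityʳ (E m)) ⟩
      p * E (suc m) + E m                          ∎
      where
      p = pow q (suc m)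

    dil-q-E-coeff : dil q E ≋ E ⊝ X ⊛ E
    dil-q-E-coeff zero    = begin
      1# * 1#         ≈⟨ *-identityˡ 1# ⟩
      1#              ≈⟨ +-identityʳ 1# ⟨
      1# + 0#         ≈⟨ +-cong refl (trans (-‿cong (X-⊛-zero E)) -0#≈0#) ⟨
      1# - (X ⊛ E) 0  ∎
    dil-q-E-coeff (suc m) = begin
      p * E (suc m)                     ≈⟨ //-rightDividesʳ (E m) (p * E (suc m)) ⟨
      (p * E (suc m) + E m) - E m       ≈⟨ +-cong (E-suc m) (-‿cong (X-⊛-suc E m)) ⟨
      E (suc m) - (X ⊛ E) (suc m)       ∎
      where
      p = pow q (suc m)

module SeriesAlgebra {c ℓ : Level} (R : CommutativeRing c ℓ) where
  open CommutativeRing R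
  open Series R
  open PowerSeries R
  open RingSums R using (pow-cong; esym-vanish)
  open import Algebra.Properties.Ring ring using (-1*x≈-x)

  module S where
    open CommutativeRing seriesRing public
    open Series seriesRing public using (sumR; prodR; pow)
    open RingSums seriesRing public
    open import Algebra.Properties.Ring (CommutativeRing.ring seriesRing) public
      using (-‿distribˡ-*; -‿distribʳ-*; x[y-z]≈xy-xz)
    open import Algebra.Properties.Group (CommutativeRing.+-group seriesRing) public
      using (x∙y⁻¹≈ε⇒x≈y)
    open import Algebra.Properties.CommutativeSemigroup (CommutativeRing.*-commutativeSemigroup seriesRing) public
      using (interchange; x∙yz≈y∙xz; x∙yz≈yx∙z; x∙yz≈z∙xy)

  open import Relation.Binary.Reasoning.Setoid S.setoid

  sumS≐sumR : ∀ n F → sumS n F ≐ S.sumR n F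
  sumS≐sumR zero    F = S.refl
  sumS≐sumR (suc n) F = S.+-cong (sumS≐sumR n F) (≐-refl (F n))

  prodS≐prodR : ∀ n F → prodS n F ≐ S.prodR n F
  prodS≐prodR zero    F = S.refl
  prodS≐prodR (suc n) F = S.*-cong (prodS≐prodR n F) (≐-refl (F n))

  powS≐pow : ∀ f n → powS f n ≐ S.pow f n
  powS≐pow f zero    = S.refl
  powS≐pow f (suc n) = S.*-cong (≐-refl f) (powS≐pow f n)

  sumS-cong : ∀ n {F G : ℕ → Series} → (∀ k → F k ≐ G k) → sumS n F ≐ sumS n G
  sumS-cong zero    F≐G = ≐-refl 0S
  sumS-cong (suc n) F≐G = S.+-cong (sumS-cong n F≐G) (F≐G n)

  sumS-head : ∀ n F → sumS (suc n) F ≐ F 0 ⊕ sumS n (λ k → F (suc k))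
  sumS-head n F = begin
    sumS (suc n) F                      ≈⟨ sumS≐sumR (suc n) F ⟩
    S.sumR (suc n) F                    ≈⟨ S.sumR-head n F ⟩
    F 0 ⊕ S.sumR n (λ k → F (suc k))    ≈⟨ S.+-cong (≐-refl (F 0)) (sumS≐sumR n _) ⟨
    F 0 ⊕ sumS n (λ k → F (suc k))      ∎

  ·S≐cS⊛ : ∀ a f → a ·S f ≐ cS a ⊛ f
  ·S≐cS⊛ a f = ≋⇒≐ (λ n → sym (cS-⊛ a f n))

  ·S-congˡ : ∀ {a b} f → a ≈ b → a ·S f ≐ b ·S f
  ·S-congˡ f a≈b = ≋⇒≐ (λ n → *-cong a≈b refl)

  ·S-congʳ : ∀ a {f g} → f ≐ g → a ·S f ≐ a ·S g
  ·S-congʳ a f≐g = ≋⇒≐ (λ n → *-cong refl (≐⇒≋ f≐g n))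

  ·S-·S : ∀ a b f → a ·S (b ·S f) ≐ (a * b) ·S f
  ·S-·S a b f = ≋⇒≐ (λ n → sym (*-assoc a b (f n)))

  ⊛-·S : ∀ a f g → f ⊛ (a ·S g) ≐ a ·S (f ⊛ g)
  ⊛-·S a f g = begin
    f ⊛ (a ·S g)     ≈⟨ S.*-cong (≐-refl f) (·S≐cS⊛ a g) ⟩
    f ⊛ (cS a ⊛ g)   ≈⟨ S.x∙yz≈y∙xz f (cS a) g ⟩
    cS a ⊛ (f ⊛ g)   ≈⟨ ·S≐cS⊛ a (f ⊛ g) ⟨
    a ·S (f ⊛ g)     ∎

  ·S-⊛ : ∀ a f g → (a ·S f) ⊛ g ≐ a ·S (f ⊛ g)
  ·S-⊛ a f g = begin
    (a ·S f) ⊛ g     ≈⟨ S.*-comm (a ·S f) g ⟩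
    g ⊛ (a ·S f)     ≈⟨ ⊛-·S a g f ⟩
    a ·S (g ⊛ f)     ≈⟨ ·S-congʳ a (S.*-comm g f) ⟩
    a ·S (f ⊛ g)     ∎

  ·S-powS≐cS⊛pow : ∀ a f k → a ·S powS f k ≐ cS a ⊛ S.pow f k
  ·S-powS≐cS⊛pow a f k = S.trans (·S≐cS⊛ a (powS f k)) (S.*-cong (≐-refl (cS a)) (powS≐pow f k))

  powS-⊖ : ∀ f k → powS (⊖ f) k ≐ pow (- 1#) k ·S powS f k
  powS-⊖ f zero    = ≋⇒≐ (λ n → sym (*-identityˡ _))
  powS-⊖ f (suc k) = begin
    ⊖ f ⊛ powS (⊖ f) k                          ≈⟨ S.*-cong (≐-refl (⊖ f)) (powS-⊖ f k) ⟩
    ⊖ f ⊛ (pow (- 1#) k ·S powS f k)            ≈⟨ ⊛-·S _ (⊖ f) (powS f k) ⟩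
    pow (- 1#) k ·S (⊖ f ⊛ powS f k)            ≈⟨ ·S-congʳ _ (S.-‿distribˡ-* f (powS f k)) ⟨
    pow (- 1#) k ·S ⊖ (f ⊛ powS f k)            ≈⟨ ·S-congʳ _ (≋⇒≐ (λ n → sym (-1*x≈-x _))) ⟩
    pow (- 1#) k ·S ((- 1#) ·S powS f (suc k))  ≈⟨ ·S-·S _ _ _ ⟩
    (pow (- 1#) k * - 1#) ·S powS f (suc k)     ≈⟨ ·S-congˡ (powS f (suc k)) (*-comm _ _) ⟩
    pow (- 1#) (suc k) ·S powS f (suc k)        ∎

  sumS-·S-⊛ʳ : ∀ n (a : ℕ → Carrier) (F : ℕ → Series) Z →
    sumS n (λ k → a k ·S (F k ⊛ Z)) ≐ sumS n (λ k → a k ·S F k) ⊛ Z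
  sumS-·S-⊛ʳ zero    a F Z = S.sym (S.zeroˡ Z)
  sumS-·S-⊛ʳ (suc n) a F Z = begin
    sumS n (λ k → a k ·S (F k ⊛ Z)) ⊕ a n ·S (F n ⊛ Z)
      ≈⟨ S.+-cong (sumS-·S-⊛ʳ n a F Z) (S.sym (·S-⊛ (a n) (F n) Z)) ⟩
    sumS n (λ k → a k ·S F k) ⊛ Z ⊕ (a n ·S F n) ⊛ Z
      ≈⟨ S.distribʳ Z _ _ ⟨
    (sumS n (λ k → a k ·S F k) ⊕ a n ·S F n) ⊛ Z ∎

  linear-⊛-polynomial : ∀ n a (c : ℕ → Carrier) → c n ≈ 0# →
    (1S ⊝ a ·S X) ⊛ sumS n (λ j → c j ·S powS (⊖ X) j) ≐
    cS (c 0) ⊕ sumS n (λ j → (c (suc j) + a * c j) ·S powS (⊖ X) (suc j))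
  linear-⊛-polynomial n a c cₙ≈0 = begin
    (1S ⊝ a ·S X) ⊛ sumS n (λ j → c j ·S powS (⊖ X) j)
      ≈⟨ S.*-cong 1⊝aX≐1⊕a[-X] polynomial≐ ⟩
    (1S ⊕ cS a ⊛ ⊖ X) ⊛ S.sumR n (λ j → cS (c j) ⊛ S.pow (⊖ X) j)
      ≈⟨ S.linear-*-polynomial n (cS a) (⊖ X) (λ j → cS (c j)) (≋⇒≐ (cS-cong cₙ≈0)) ⟩
    cS (c 0) ⊕ S.sumR n (λ j → (cS (c (suc j)) ⊕ cS a ⊛ cS (c j)) ⊛ S.pow (⊖ X) (suc j))
      ≈⟨ S.+-cong (≐-refl (cS (c 0))) (S.sumR-cong n (λ j → S.sym (coefficient j))) ⟩
    cS (c 0) ⊕ S.sumR n (λ j → (c (suc j) + a * c j) ·S powS (⊖ X) (suc j))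
      ≈⟨ S.+-cong (≐-refl (cS (c 0))) (sumS≐sumR n _) ⟨
    cS (c 0) ⊕ sumS n (λ j → (c (suc j) + a * c j) ·S powS (⊖ X) (suc j)) ∎
    where
    polynomial≐ : sumS n (λ j → c j ·S powS (⊖ X) j) ≐ S.sumR n (λ j → cS (c j) ⊛ S.pow (⊖ X) j)
    polynomial≐ = S.trans (sumS≐sumR n _) (S.sumR-cong n (λ j → ·S-powS≐cS⊛pow (c j) (⊖ X) j))
    1⊝aX≐1⊕a[-X] : 1S ⊝ a ·S X ≐ 1S ⊕ cS a ⊛ ⊖ X
    1⊝aX≐1⊕a[-X] = S.+-cong (≐-refl 1S) (S.trans (S.-‿cong (·S≐cS⊛ a X)) (S.-‿distribʳ-* (cS a) X))
    coefficient : ∀ j → (c (suc j) + a * c j) ·S powS (⊖ X) (suc j) ≐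
                        (cS (c (suc j)) ⊕ cS a ⊛ cS (c j)) ⊛ S.pow (⊖ X) (suc j)
    coefficient j = S.trans (·S-powS≐cS⊛pow _ (⊖ X) (suc j)) (S.*-cong cS-hom (≐-refl (S.pow (⊖ X) (suc j))))
      where
      cS-hom : cS (c (suc j) + a * c j) ≐ cS (c (suc j)) ⊕ cS a ⊛ cS (c j)
      cS-hom = ≋⇒≐ (λ n → trans (cS-+ _ _ n) (+-cong refl (cS-* a (c j) n)))

  prodS-linear≐sumS-esym : ∀ {s} (v : Vec Carrier s) (F : ℕ → Carrier) →
    (∀ j (j<s : j < s) → F j ≈ lookup v (fromℕ< j<s)) →
    prodS s (λ j → 1S ⊝ F j ·S X) ≐ sumS (suc s) (λ j → esym j v ·S powS (⊖ X) j)
  prodS-linear≐sumS-esym []      F F≈v = S.sym (S.trans (S.+-identityˡ _) (≋⇒≐ (λ n → *-identityˡ _)))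
  prodS-linear≐sumS-esym {suc s} (a ∷ v) F F≈v = begin
    prodS (suc s) (λ j → 1S ⊝ F j ·S X)
      ≈⟨ prodS≐prodR (suc s) _ ⟩
    S.prodR (suc s) (λ j → 1S ⊝ F j ·S X)
      ≈⟨ S.prodR-head s _ ⟩
    (1S ⊝ F 0 ·S X) ⊛ S.prodR s (λ j → 1S ⊝ F (suc j) ·S X)
      ≈⟨ S.*-cong F₀≈a (S.sym (prodS≐prodR s _)) ⟩
    (1S ⊝ a ·S X) ⊛ prodS s (λ j → 1S ⊝ F (suc j) ·S X)
      ≈⟨ S.*-cong (≐-refl (1S ⊝ a ·S X)) (prodS-linear≐sumS-esym v (λ j → F (suc j)) F[1+j]≈v) ⟩
    (1S ⊝ a ·S X) ⊛ sumS (suc s) (λ j → esym j v ·S powS (⊖ X) j)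
      ≈⟨ linear-⊛-polynomial (suc s) a (λ j → esym j v) (esym-vanish v (suc s) ℕ.≤-refl) ⟩
    1S ⊕ sumS (suc s) (λ j → esym (suc j) (a ∷ v) ·S powS (⊖ X) (suc j))
      ≈⟨ S.+-cong (≋⇒≐ (λ n → *-identityˡ _)) (≐-refl _) ⟨
    esym 0 (a ∷ v) ·S powS (⊖ X) 0 ⊕ sumS (suc s) (λ j → esym (suc j) (a ∷ v) ·S powS (⊖ X) (suc j))
      ≈⟨ sumS-head (suc s) _ ⟨
    sumS (suc (suc s)) (λ j → esym j (a ∷ v) ·S powS (⊖ X) j) ∎
    where
    F[1+j]≈v : ∀ j (j<s : j < s) → F (suc j) ≈ lookup v (fromℕ< j<s)
    F[1+j]≈v j j<s = F≈v (suc j) (s≤s j<s)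
    F₀≈a : 1S ⊝ F 0 ·S X ≐ 1S ⊝ a ·S X
    F₀≈a = ≋⇒≐ (λ n → +-cong refl (-‿cong (*-cong (F≈v 0 (s≤s z≤n)) refl)))

  ⊛-cancelˡ : ∀ f {a b} → f 0 ≈ 1# → f ⊛ a ≐ f ⊛ b → a ≐ b
  ⊛-cancelˡ f {a} {b} f₀≈1 fa≐fb =
    S.x∙y⁻¹≈ε⇒x≈y a b (≋⇒≐ (f⊛δ≋0⇒δ≋0 f (a ⊝ b) f₀≈1 (≐⇒≋ f⊛[a-b]≐0)))
    where
    f⊛[a-b]≐0 : f ⊛ (a ⊝ b) ≐ 0S
    f⊛[a-b]≐0 = begin
      f ⊛ (a ⊝ b)       ≈⟨ S.x[y-z]≈xy-xz f a b ⟩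
      f ⊛ a ⊝ f ⊛ b     ≈⟨ S.+-cong fa≐fb (≐-refl (⊖ (f ⊛ b))) ⟩
      f ⊛ b ⊝ f ⊛ b     ≈⟨ S.-‿inverseʳ (f ⊛ b) ⟩
      0S                ∎

  dil-congˡ : ∀ {a b} f → a ≈ b → dil a f ≐ dil b f
  dil-congˡ f a≈b = ≋⇒≐ (λ n → *-cong (pow-cong n a≈b) refl)

  dil-1⊝X : ∀ a → dil a (1S ⊝ X) ≐ 1S ⊝ a ·S X
  dil-1⊝X a = ≋⇒≐ (λ n →
    trans (dil-⊕ a 1S (⊖ X) n) (+-cong (dil-cS a 1# n) (trans (dil-⊖ a X n) (-‿cong (dil-X a n)))))

  module Euler (q : Carrier) (inv : ℕ → Carrier) (inv-spec : ∀ t → (1# - pow q (suc t)) * inv t ≈ 1#) where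
    open WithQ q inv
    open EulerCoefficients q inv inv-spec using (dil-q-E-coeff)

    dil-q-E : dil q E ≐ (1S ⊝ X) ⊛ E
    dil-q-E = begin
      dil q E               ≈⟨ ≋⇒≐ dil-q-E-coeff ⟩
      E ⊝ X ⊛ E             ≈⟨ S.+-cong (S.sym (S.*-identityˡ E)) (S.-‿distribˡ-* X E) ⟩
      1S ⊛ E ⊕ (⊖ X) ⊛ E    ≈⟨ S.distribʳ E 1S (⊖ X) ⟨
      (1S ⊝ X) ⊛ E          ∎

    qPochhammer : ℕ → Series
    qPochhammer j = prodS j (λ h → 1S ⊝ pow q (suc h) ·S X)

    dil-q^[1+j]-E : ∀ j → dil (pow q (suc j)) E ≐ qPochhammer j ⊛ dil q E
    dil-q^[1+j]-E zero    = S.trans (dil-congˡ E (*-identityʳ q)) (S.sym (S.*-identityˡ (dil q E)))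
    dil-q^[1+j]-E (suc j) = begin
      dil (q * q^[1+j]) E                              ≈⟨ dil-congˡ E (*-comm q q^[1+j]) ⟩
      dil (q^[1+j] * q) E                              ≈⟨ ≋⇒≐ (dil-dil q^[1+j] q E) ⟨
      dil q^[1+j] (dil q E)                            ≈⟨ ≋⇒≐ (dil-cong q^[1+j] (≐⇒≋ dil-q-E)) ⟩
      dil q^[1+j] ((1S ⊝ X) ⊛ E)                       ≈⟨ ≋⇒≐ (dil-⊛ q^[1+j] (1S ⊝ X) E) ⟩
      dil q^[1+j] (1S ⊝ X) ⊛ dil q^[1+j] E             ≈⟨ S.*-cong (dil-1⊝X q^[1+j]) (dil-q^[1+j]-E j) ⟩
      (1S ⊝ q^[1+j] ·S X) ⊛ (qPochhammer j ⊛ dil q E)  ≈⟨ S.x∙yz≈yx∙z _ (qPochhammer j) (dil q E) ⟩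
      (qPochhammer j ⊛ (1S ⊝ q^[1+j] ·S X)) ⊛ dil q E  ∎
      where
      q^[1+j] = pow q (suc j)

module FunctionalEquations {ℓ₁ ℓ₂ : Level} (R : CommutativeRing ℓ₁ ℓ₂) where
  open CommutativeRing R
  open Series R
  open PowerSeries R
  open SeriesAlgebra R
  open RingSums R using (esym-vanish; esym-map-*; pow-[-1]-suc-suc)
  open import Relation.Binary.Reasoning.Setoid S.setoid

  module Equations (q : Carrier) (inv : ℕ → Carrier) (inv-spec : ∀ t → (1# - pow q (suc t)) * inv t ≈ 1#)
                   (s : ℕ) (d : Carrier) (u : Vec Carrier s) where
    open WithQ q inv
    open WithParams (suc s) d u
    open Euler q inv inv-spec

    esymSeries : Series
    esymSeries = sumS (suc s) (λ j → (pow d j * e j) ·S powS (⊖ X) j)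

    GFactor : Series
    GFactor = 1S ⊕ sumS (suc s) (λ j → (pow d j * e j + pow d (suc j) * e (suc j)) ·S powS (⊖ X) (suc j))

    GFactor≐[1-x]esymSeries : GFactor ≐ (1S ⊝ X) ⊛ esymSeries
    GFactor≐[1-x]esymSeries = S.sym (begin
      (1S ⊝ X) ⊛ esymSeries
        ≈⟨ S.*-cong (≋⇒≐ (λ n → +-cong refl (-‿cong (*-identityˡ (X n))))) (≐-refl esymSeries) ⟨
      (1S ⊝ 1# ·S X) ⊛ esymSeries
        ≈⟨ linear-⊛-polynomial (suc s) 1# c c₁₊ₛ≈0 ⟩
      cS (c 0) ⊕ sumS (suc s) (λ j → (c (suc j) + 1# * c j) ·S powS (⊖ X) (suc j))
        ≈⟨ S.+-cong (≋⇒≐ (cS-cong (*-identityˡ 1#))) (sumS-cong (suc s) (λ j → ·S-congˡ _ (swap j))) ⟩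
      GFactor ∎)
      where
      c : ℕ → Carrier
      c j = pow d j * e j
      c₁₊ₛ≈0 : c (suc s) ≈ 0#
      c₁₊ₛ≈0 = trans (*-cong refl (esym-vanish u (suc s) ℕ.≤-refl)) (zeroʳ _)
      swap : ∀ j → c (suc j) + 1# * c j ≈ c j + c (suc j)
      swap j = trans (+-cong refl (*-identityˡ (c j))) (+-comm _ _)

    -- The coefficient of x^m G(x q^i) in GEquation, for m = k + 1.
    GCoeff : ℕ → ℕ → Carrier
    GCoeff i k = (pow d k * e (i N.+ suc k ∸ 1) + pow d (suc k) * e (i N.+ suc k))
                   * qbin (i N.+ suc k ∸ 1) k * pow (- 1#) (suc (suc k))

    GMonomial : ℕ → ℕ → Series
    GMonomial i k = GCoeff i k ·S powS X (suc k)

    gSummand : ℕ → ℕ → Series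
    gSummand i m = (pow d m * e (i N.+ m)) ·S (lowerPart i m ⊕ qbin (i N.+ m) m ·S (X ⊛ powS (⊖ X) m))

    -- Summation by parts: GCoeff pairs two consecutive d^m e_{i+m} with one q-binomial term,
    -- coeffg pairs one d^m e_{i+m} with two consecutive q-binomial terms.
    ΣGMonomial≐ΣgSummand : ∀ i n → e (i N.+ n) ≈ 0# → sumS n (GMonomial i) ≐ sumS n (gSummand i)
    ΣGMonomial≐ΣgSummand i n eᵢ₊ₙ≈0 = begin
      sumS n (GMonomial i)
        ≈⟨ sumS≐sumR n (GMonomial i) ⟩
      S.sumR n (GMonomial i)
        ≈⟨ S.sumR-cong n GMonomial≐ ⟩
      S.sumR n (λ k → (a k ⊕ a (suc k)) ⊛ b k)
        ≈⟨ S.sumR-by-parts n a b (lowerPart i) aₙ≐0 (≐-refl 0S) (λ m → ≐-refl (b m)) ⟩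
      S.sumR n (λ m → a m ⊛ (lowerPart i m ⊕ b m))
        ≈⟨ S.sumR-cong n (λ m → ·S≐cS⊛ _ _) ⟨
      S.sumR n (gSummand i)
        ≈⟨ sumS≐sumR n (gSummand i) ⟨
      sumS n (gSummand i) ∎
      where
      a b : ℕ → Series
      a m = cS (pow d m * e (i N.+ m))
      b k = qbin (i N.+ k) k ·S (X ⊛ powS (⊖ X) k)
      aₙ≐0 : a n ≐ 0S
      aₙ≐0 = ≋⇒≐ (cS-cong (trans (*-cong refl eᵢ₊ₙ≈0) (zeroʳ _)))
      GMonomial≐ : ∀ k → GMonomial i k ≐ (a k ⊕ a (suc k)) ⊛ b k
      GMonomial≐ k = S.sym (begin
        (a k ⊕ a (suc k)) ⊛ b k
          ≈⟨ S.*-cong (≋⇒≐ (λ n → sym (cS-+ x y n))) (≐-refl (b k)) ⟩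
        cS (x + y) ⊛ b k
          ≈⟨ ·S≐cS⊛ (x + y) (b k) ⟨
        (x + y) ·S b k
          ≈⟨ ·S-·S _ _ _ ⟩
        ((x + y) * B) ·S (X ⊛ powS (⊖ X) k)
          ≈⟨ ·S-congʳ _ (S.*-cong (≐-refl X) (powS-⊖ X k)) ⟩
        ((x + y) * B) ·S (X ⊛ (pow (- 1#) k ·S powS X k))
          ≈⟨ ·S-congʳ _ (⊛-·S _ X (powS X k)) ⟩
        ((x + y) * B) ·S (pow (- 1#) k ·S powS X (suc k))
          ≈⟨ ·S-·S _ _ _ ⟩
        ((x + y) * B * pow (- 1#) k) ·S powS X (suc k)
          ≈⟨ ·S-congˡ _ GCoeff≈ ⟨
        GMonomial i k ∎)
        where
        x = pow d k * e (i N.+ k)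
        y = pow d (suc k) * e (i N.+ suc k)
        B = qbin (i N.+ k) k
        i+1+k∸1≡i+k : i N.+ suc k ∸ 1 ≡ i N.+ k
        i+1+k∸1≡i+k = ≡.cong (_∸ 1) (ℕ.+-suc i k)
        GCoeff≈ : GCoeff i k ≈ (x + y) * B * pow (- 1#) k
        GCoeff≈ = *-cong (reflexive (≡.cong (λ t → (pow d k * e t + y) * qbin t k) i+1+k∸1≡i+k))
                         (pow-[-1]-suc-suc k)

    module Factorisation (g G : Series) (G≋gE : G ≋ g ⊛ E) where
      -- gEquation's local helper lookupU has no name outside Defs; unifying with the unfolded
      -- gEquation recovers it.
      lookupUOf : {F : ℕ → Carrier} {B : Series} (T : Set ℓ₂) →
                  T ≡ (prodS s (λ j → 1S ⊝ (d * F j) ·S X) ⊛ g ≋ B) → ℕ → Carrier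
      lookupUOf {F} _ _ = F

      lookupU : ℕ → Carrier
      lookupU = lookupUOf (gEquation g) ≡.refl

      lookupU≈lookup : ∀ j (j<s : j < s) → lookupU j ≈ lookup u (fromℕ< j<s)
      lookupU≈lookup j j<s with j N.<? s
      ... | yes _   = refl
      ... | no j≮s = contradiction j<s j≮s

      gFactor : Series
      gFactor = prodS s (λ j → 1S ⊝ (d * lookupU j) ·S X)

      gFactor≐esymSeries : gFactor ≐ esymSeries
      gFactor≐esymSeries = begin
        gFactor
          ≈⟨ prodS-linear≐sumS-esym (map (d *_) u) (λ j → d * lookupU j) d·lookupU≈lookup ⟩
        sumS (suc s) (λ j → esym j (map (d *_) u) ·S powS (⊖ X) j)
          ≈⟨ sumS-cong (suc s) (λ j → ·S-congˡ _ (esym-map-* d u j)) ⟩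
        esymSeries ∎
        where
        d·lookupU≈lookup : ∀ j (j<s : j < s) → d * lookupU j ≈ lookup (map (d *_) u) (fromℕ< j<s)
        d·lookupU≈lookup j j<s =
          trans (*-cong refl (lookupU≈lookup j j<s)) (reflexive (≡.sym (lookup-map (fromℕ< j<s) (d *_) u)))

      gTerm : ℕ → Series
      gTerm j = coeffg (suc j) ⊛ qPochhammer j ⊛ dil (pow q (suc j)) g

      gRHS : Series
      gRHS = dil q g ⊕ sumS s gTerm

      GSummand : ℕ → ℕ → Series
      GSummand j k = GCoeff (suc j) k ·S (powS X (suc k) ⊛ dil (pow q (suc j)) G)

      GTerm : ℕ → Series
      GTerm j = sumS (s ∸ j) (GSummand j)

      GRHS : Series
      GRHS = dil q G ⊕ sumS (suc s) GTerm

      E[qx] : Series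
      E[qx] = dil q E

      G₀≈g₀ : G 0 ≈ g 0
      G₀≈g₀ = trans (G≋gE 0) (trans (+-identityˡ _) (*-identityʳ (g 0)))

      dil-G : ∀ a → dil a G ≐ dil a g ⊛ dil a E
      dil-G a = S.trans (≋⇒≐ (dil-cong a G≋gE)) (≋⇒≐ (dil-⊛ a g E))

      GLHS≐E[qx]⊛gLHS : GFactor ⊛ G ≐ E[qx] ⊛ (gFactor ⊛ g)
      GLHS≐E[qx]⊛gLHS = begin
        GFactor ⊛ G
          ≈⟨ S.*-cong GFactor≐[1-x]esymSeries (≋⇒≐ G≋gE) ⟩
        ((1S ⊝ X) ⊛ esymSeries) ⊛ (g ⊛ E)
          ≈⟨ S.*-cong (≐-refl ((1S ⊝ X) ⊛ esymSeries)) (S.*-comm g E) ⟩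
        ((1S ⊝ X) ⊛ esymSeries) ⊛ (E ⊛ g)
          ≈⟨ S.interchange (1S ⊝ X) esymSeries E g ⟩
        ((1S ⊝ X) ⊛ E) ⊛ (esymSeries ⊛ g)
          ≈⟨ S.*-cong dil-q-E (S.*-cong gFactor≐esymSeries (≐-refl g)) ⟨
        E[qx] ⊛ (gFactor ⊛ g) ∎

      GTerm≐E[qx]⊛gTerm : ∀ j → j < s → GTerm j ≐ E[qx] ⊛ gTerm j
      GTerm≐E[qx]⊛gTerm j j<s = begin
        GTerm j
          ≈⟨ sumS-·S-⊛ʳ (s ∸ j) (GCoeff (suc j)) (λ k → powS X (suc k)) (dil q^[1+j] G) ⟩
        sumS (s ∸ j) (GMonomial (suc j)) ⊛ dil q^[1+j] G
          ≈⟨ S.*-cong (S.reflexive (≡.cong (λ n → sumS n (GMonomial (suc j))) s∸j≡1+[s∸1+j]))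
                      (dil-G q^[1+j]) ⟩
        sumS (suc (s ∸ suc j)) (GMonomial (suc j)) ⊛ (dil q^[1+j] g ⊛ dil q^[1+j] E)
          ≈⟨ S.*-cong (ΣGMonomial≐ΣgSummand (suc j) (suc (s ∸ suc j)) eᵣ≈0)
                      (S.*-cong (≐-refl (dil q^[1+j] g)) (dil-q^[1+j]-E j)) ⟩
        coeffg (suc j) ⊛ (dil q^[1+j] g ⊛ (qPochhammer j ⊛ E[qx]))
          ≈⟨ S.*-cong (≐-refl (coeffg (suc j))) (S.x∙yz≈yx∙z (dil q^[1+j] g) (qPochhammer j) E[qx]) ⟩
        coeffg (suc j) ⊛ ((qPochhammer j ⊛ dil q^[1+j] g) ⊛ E[qx])
          ≈⟨ S.x∙yz≈z∙xy (coeffg (suc j)) (qPochhammer j ⊛ dil q^[1+j] g) E[qx] ⟩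
        E[qx] ⊛ (coeffg (suc j) ⊛ (qPochhammer j ⊛ dil q^[1+j] g))
          ≈⟨ S.*-cong (≐-refl E[qx]) (S.*-assoc (coeffg (suc j)) (qPochhammer j) (dil q^[1+j] g)) ⟨
        E[qx] ⊛ gTerm j ∎
        where
        q^[1+j] = pow q (suc j)
        s∸j≡1+[s∸1+j] : s ∸ j ≡ suc (s ∸ suc j)
        s∸j≡1+[s∸1+j] = ℕ.+-∸-assoc 1 j<s
        1+j+[1+[s∸1+j]]≡1+s : suc j N.+ suc (s ∸ suc j) ≡ suc s
        1+j+[1+[s∸1+j]]≡1+s = ≡.trans (ℕ.+-suc (suc j) (s ∸ suc j)) (≡.cong suc (ℕ.m+[n∸m]≡n j<s))
        eᵣ≈0 : e (suc j N.+ suc (s ∸ suc j)) ≈ 0#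
        eᵣ≈0 = trans (reflexive (≡.cong e 1+j+[1+[s∸1+j]]≡1+s)) (esym-vanish u (suc s) ℕ.≤-refl)

      GRHS≐E[qx]⊛gRHS : GRHS ≐ E[qx] ⊛ gRHS
      GRHS≐E[qx]⊛gRHS = begin
        dil q G ⊕ (sumS s GTerm ⊕ GTerm s)
          ≈⟨ S.+-cong (S.trans (dil-G q) (S.*-comm (dil q g) E[qx])) (S.+-cong ΣGTerm≐ GTermₛ≐0) ⟩
        E[qx] ⊛ dil q g ⊕ (E[qx] ⊛ sumS s gTerm ⊕ 0S)
          ≈⟨ S.+-cong (≐-refl (E[qx] ⊛ dil q g)) (S.+-identityʳ (E[qx] ⊛ sumS s gTerm)) ⟩
        E[qx] ⊛ dil q g ⊕ E[qx] ⊛ sumS s gTerm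
          ≈⟨ S.distribˡ E[qx] (dil q g) (sumS s gTerm) ⟨
        E[qx] ⊛ gRHS ∎
        where
        ΣGTerm≐ : sumS s GTerm ≐ E[qx] ⊛ sumS s gTerm
        ΣGTerm≐ = begin
          sumS s GTerm                          ≈⟨ sumS≐sumR s GTerm ⟩
          S.sumR s GTerm                        ≈⟨ S.sumR-cong< s GTerm≐E[qx]⊛gTerm ⟩
          S.sumR s (λ j → E[qx] ⊛ gTerm j)      ≈⟨ S.*-distribˡ-sumR s E[qx] gTerm ⟨
          E[qx] ⊛ S.sumR s gTerm                ≈⟨ S.*-cong (≐-refl E[qx]) (sumS≐sumR s gTerm) ⟨
          E[qx] ⊛ sumS s gTerm                  ∎
        GTermₛ≐0 : GTerm s ≐ 0S
        GTermₛ≐0 = S.reflexive (≡.cong (λ n → sumS n (GSummand s)) (ℕ.n∸n≡0 s))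

lemma3p8 : {c ℓ : Level} (R : CommutativeRing c ℓ) →
    let open CommutativeRing R
        open Series R in
    (r : ℕ) → 2 N.≤ r →
    (q d : Carrier) (u : Vec Carrier (r ∸ 1)) →
    (inv : ℕ → Carrier) → (∀ t → (1# - pow q (suc t)) * inv t ≈ 1#) →
    let open WithQ q inv
        open WithParams r d u in
    (g G : Series) → G ≋ g ⊛ E →
    ((g 0 ≈ 1#) × gEquation g) ⇔ ((G 0 ≈ 1#) × GEquation G)
lemma3p8 R zero    ()
lemma3p8 R (suc s) _ q d u inv inv-spec g G G≋gE = mk⇔ to from
  where
  open CommutativeRing R
  open Series R
  open WithQ q inv
  open WithParams (suc s) d u
  open PowerSeries R using (≋⇒≐; ≐⇒≋; ≐-refl)
  open SeriesAlgebra R using (module S; ⊛-cancelˡ)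
  open FunctionalEquations.Equations R q inv inv-spec s d u
  open Factorisation g G G≋gE
  open import Relation.Binary.Reasoning.Setoid S.setoid

  to : (g 0 ≈ 1#) × gEquation g → (G 0 ≈ 1#) × GEquation G
  to (g₀≈1 , g-eq) = trans G₀≈g₀ g₀≈1 , ≐⇒≋ (begin
    GFactor ⊛ G            ≈⟨ GLHS≐E[qx]⊛gLHS ⟩
    E[qx] ⊛ (gFactor ⊛ g)  ≈⟨ S.*-cong (≐-refl E[qx]) (≋⇒≐ g-eq) ⟩
    E[qx] ⊛ gRHS           ≈⟨ GRHS≐E[qx]⊛gRHS ⟨
    GRHS                   ∎)

  from : (G 0 ≈ 1#) × GEquation G → (g 0 ≈ 1#) × gEquation g
  from (G₀≈1 , G-eq) = trans (sym G₀≈g₀) G₀≈1 , ≐⇒≋ (⊛-cancelˡ E[qx] (*-identityˡ 1#) (begin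
    E[qx] ⊛ (gFactor ⊛ g)  ≈⟨ GLHS≐E[qx]⊛gLHS ⟨
    GFactor ⊛ G            ≈⟨ ≋⇒≐ G-eq ⟩
    GRHS                   ≈⟨ GRHS≐E[qx]⊛gRHS ⟩
    E[qx] ⊛ gRHS           ∎))
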